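{- Let $L$ be a complete commutative residuated lattice, $X,X',A$ $L$-enriched categories, $R\colon X\to A$, $\mu\colon X\to L$, $R'\colon X'\to A$, $\mu'\colon X'\to L$ $L$-enriched functors, and $i\colon X\to X'$ an $L$-enriched functor with $R'\circ i=R$ and $\mu'\circ i=\mu$ (an update from $\langle R,\mu\rangle$ to $\langle R',\mu'\rangle$). Then $\overline{R}\mu\trianglelefteq\overline{R'}\mu'$ and $\underline{R'}\mu'\trianglelefteq\underline{R}\mu$.
   Context: A complete commutative residuated lattice is a complete lattice $(L,\preceq)$ with a commutative monoid $(1,\cdot)$ such that each $p\cdot(-)$ has a right adjoint $p\Rightarrow(-)$: $p\cdot q\preceq r$ iff $q\preceq(p\Rightarrow r)$. An $L$-enriched category $X$ is a set with $X(-,-)\colon X\times X\to L$ satisfying $1\preceq X(x,x)$ and $X(y,z)\cdot X(x,y)\preceq X(x,z)$. An $L$-enriched functor $F\colon X\to Y$ is a function with $X(x,x')\preceq Y(Fx,Fx')$. $L$ is an $L$-enriched category with $L(p,q)=(p\Rightarrow q)$; $L^{X}$ is the set of $L$-enriched functors $X\to L$ with $L^{X}(\mu,\nu)=\bigwedge_x(\mu x\Rightarrow\nu x)$. For $L$-enriched functors $F,G\colon X\to Y$, $F\trianglelefteq G$ means $1\preceq Y(Fx,Gx)$ for all $x\in X$ (for $\mu,\nu\in L^{A}$ this means $\mu a\preceq\nu a$ for all $a$). For an $L$-enriched functor $S\colon X\to A$, $S^{*}\colon L^{A}\to L^{X}$ is $S^{*}\nu=\nu\circ S$; the $L$-enriched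 upper approximation $\overline{S}\colon L^{X}\to L^{A}$ is the left $L$-enriched adjoint of $S^{*}$ and the $L$-enriched lower approximation $\underline{S}$ is the right $L$-enriched adjoint, where $F\colon X\to Y$ is left $L$-enriched adjoint to $G\colon Y\to X$ if $Y(Fx,y)=X(x,Gy)$ for all $x,y$. -}

module Defs where

open import Level using (Level; _⊔_) renaming (suc to lsuc)
open import Data.Product using (_×_)
open import Relation.Binary.PropositionalEquality using (_≡_)
open import Relation.Binary.Structures using (IsPartialOrder)
open import Algebra.Structures using (IsCommutativeMonoid)

-- A complete commutative residuated lattice.  Completeness is with respect
-- to families indexed by types in the universe level o (Agda is predicative).
record CCRL (c ℓ o : Level) : Set (lsuc (c ⊔ ℓ ⊔ o)) where
  infix 4 _≼_
  infixl 7 _·_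
  infixr 5 _⇒_
  field
    Carrier        : Set c
    _≼_            : Carrier → Carrier → Set ℓ
    isPartialOrder : IsPartialOrder _≡_ _≼_
    ⋁              : {I : Set o} → (I → Carrier) → Carrier
    ⋁-upper        : {I : Set o} (f : I → Carrier) (i : I) → f i ≼ ⋁ f
    ⋁-least        : {I : Set o} (f : I → Carrier) (p : Carrier) →
                     ((i : I) → f i ≼ p) → ⋁ f ≼ p
    ⋀              : {I : Set o} → (I → Carrier) → Carrier
    ⋀-lower        : {I : Set o} (f : I → Carrier) (i : I) → ⋀ f ≼ f i
    ⋀-greatest     : {I : Set o} (f : I → Carrier) (p : Carrier) →
                     ((i : I) → p ≼ f i) → p ≼ ⋀ f
    𝟙              : Carrier
    _·_            : Carrier → Carrier → Carrier
    isCommutativeMonoid : IsCommutativeMonoid _≡_ _·_ 𝟙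
    _⇒_            : Carrier → Carrier → Carrier
    residuate      : (p q r : Carrier) → p · q ≼ r → q ≼ p ⇒ r
    unresiduate    : (p q r : Carrier) → q ≼ p ⇒ r → p · q ≼ r

module Enriched {c ℓ o : Level} (L : CCRL c ℓ o) where
  open CCRL L

  record ECat : Set (lsuc o ⊔ c ⊔ ℓ) where
    field
      Obj   : Set o
      hom   : Obj → Obj → Carrier
      ident : (x : Obj) → 𝟙 ≼ hom x x
      comp  : (x y z : Obj) → hom y z · hom x y ≼ hom x z
  open ECat public

  record EFunctor (X Y : ECat) : Set (o ⊔ ℓ) where
    field
      fun  : Obj X → Obj Y
      fmap : (x x' : Obj X) → hom X x x' ≼ hom Y (fun x) (fun x')
  open EFunctor public

  -- L-enriched functors X → L, i.e. objects of L^X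
  record PSh (X : ECat) : Set (o ⊔ c ⊔ ℓ) where
    field
      ap   : Obj X → Carrier
      apmap : (x x' : Obj X) → hom X x x' ≼ (ap x ⇒ ap x')
  open PSh public

  PHom : (X : ECat) → PSh X → PSh X → Carrier
  PHom X μ ν = ⋀ (λ (x : Obj X) → ap μ x ⇒ ap ν x)

  _⊴_ : {A : ECat} → PSh A → PSh A → Set (o ⊔ ℓ)
  _⊴_ {A} μ ν = (a : Obj A) → ap μ a ≼ ap ν a

  private
    ≼-trans : {p q r : Carrier} → p ≼ q → q ≼ r → p ≼ r
    ≼-trans = IsPartialOrder.trans isPartialOrder

  _* : {X A : ECat} → EFunctor X A → PSh A → PSh X
  _* {X} {A} S ν = record
    { ap = λ x → ap ν (fun S x)
    ; apmap = λ x x' → ≼-trans (fmap S x x') (apmap ν (fun S x) (fun S x')) }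

  IsEFun : (X A : ECat) → (PSh X → PSh A) → Set (o ⊔ c ⊔ ℓ)
  IsEFun X A F = (μ μ' : PSh X) → PHom X μ μ' ≼ PHom A (F μ) (F μ')

  IsUpperApprox : {X A : ECat} → EFunctor X A → (PSh X → PSh A) → Set (o ⊔ c ⊔ ℓ)
  IsUpperApprox {X} {A} S F =
    IsEFun X A F × ((μ : PSh X) (ν : PSh A) → PHom A (F μ) ν ≡ PHom X μ ((S *) ν))

  IsLowerApprox : {X A : ECat} → EFunctor X A → (PSh X → PSh A) → Set (o ⊔ c ⊔ ℓ)
  IsLowerApprox {X} {A} S G =
    IsEFun X A G × ((ν : PSh A) (μ : PSh X) → PHom X ((S *) ν) μ ≡ PHom A ν (G μ))

{-# OPTIONS --safe #-}
-- Since 𝟙 ≼ PHom μ ν holds exactly when μ ⊴ ν, each enriched adjunction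
-- F ⊣ S* (resp. S* ⊣ G) restricts to a Galois connection for ⊴.  The unit
-- μ' ⊴ R'* (upR' μ') restricts along i to μ ⊴ R* (upR' μ'), whose transpose
-- is upR μ ⊴ upR' μ'; dually, the counit R'* (loR' μ') ⊴ μ' restricts to
-- R* (loR' μ') ⊴ μ, whose transpose is loR' μ' ⊴ loR μ.
module Submission where

open import Defs
open import Level using (Level)
open import Data.Product using (_×_; _,_; proj₂)
open import Function using (_∘_)
open import Relation.Binary.PropositionalEquality using (_≡_; cong; subst; subst₂; sym)
open import Relation.Binary.Structures using (IsPartialOrder)
open import Algebra.Structures using (IsCommutativeMonoid)

module Approximations {c ℓ o : Level} (L : CCRL c ℓ o) where
  open CCRL L
  open Enriched L
  open IsCommutativeMonoid isCommutativeMonoid using (identityʳ)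

  residuate-𝟙 : {p q : Carrier} → p ≼ q → 𝟙 ≼ p ⇒ q
  residuate-𝟙 {p} {q} p≼q = residuate p 𝟙 q (subst (_≼ q) (sym (identityʳ p)) p≼q)

  unresiduate-𝟙 : {p q : Carrier} → 𝟙 ≼ p ⇒ q → p ≼ q
  unresiduate-𝟙 {p} {q} 𝟙≼p⇒q =
    subst (_≼ q) (identityʳ p) (unresiduate p 𝟙 q 𝟙≼p⇒q)

  ⊴-refl : {X : ECat} (μ : PSh X) → μ ⊴ μ
  ⊴-refl _ _ = IsPartialOrder.refl isPartialOrder

  ⊴⇒𝟙≼PHom : {X : ECat} (μ ν : PSh X) → μ ⊴ ν → 𝟙 ≼ PHom X μ ν
  ⊴⇒𝟙≼PHom _ _ μ⊴ν = ⋀-greatest _ 𝟙 (residuate-𝟙 ∘ μ⊴ν)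

  𝟙≼PHom⇒⊴ : {X : ECat} (μ ν : PSh X) → 𝟙 ≼ PHom X μ ν → μ ⊴ ν
  𝟙≼PHom⇒⊴ _ _ 𝟙≼μ⇒ν x =
    unresiduate-𝟙 (IsPartialOrder.trans isPartialOrder 𝟙≼μ⇒ν (⋀-lower _ x))

  module UpperApprox {X A : ECat} (S : EFunctor X A) (F : PSh X → PSh A)
                     (isUpper : IsUpperApprox S F) where

    ⊴⇒⊴* : (μ : PSh X) (ν : PSh A) → F μ ⊴ ν → μ ⊴ (S *) ν
    ⊴⇒⊴* μ ν =
      𝟙≼PHom⇒⊴ μ ((S *) ν) ∘ subst (𝟙 ≼_) (proj₂ isUpper μ ν) ∘ ⊴⇒𝟙≼PHom (F μ) ν

    ⊴*⇒⊴ : (μ : PSh X) (ν : PSh A) → μ ⊴ (S *) ν → F μ ⊴ ν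
    ⊴*⇒⊴ μ ν =
      𝟙≼PHom⇒⊴ (F μ) ν ∘ subst (𝟙 ≼_) (sym (proj₂ isUpper μ ν)) ∘ ⊴⇒𝟙≼PHom μ ((S *) ν)

    unit : (μ : PSh X) → μ ⊴ (S *) (F μ)
    unit μ = ⊴⇒⊴* μ (F μ) (⊴-refl (F μ))

  module LowerApprox {X A : ECat} (S : EFunctor X A) (G : PSh X → PSh A)
                     (isLower : IsLowerApprox S G) where

    ⊴⇒*⊴ : (ν : PSh A) (μ : PSh X) → ν ⊴ G μ → (S *) ν ⊴ μ
    ⊴⇒*⊴ ν μ =
      𝟙≼PHom⇒⊴ ((S *) ν) μ ∘ subst (𝟙 ≼_) (sym (proj₂ isLower ν μ)) ∘ ⊴⇒𝟙≼PHom ν (G μ)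

    *⊴⇒⊴ : (ν : PSh A) (μ : PSh X) → (S *) ν ⊴ μ → ν ⊴ G μ
    *⊴⇒⊴ ν μ =
      𝟙≼PHom⇒⊴ ν (G μ) ∘ subst (𝟙 ≼_) (proj₂ isLower ν μ) ∘ ⊴⇒𝟙≼PHom ((S *) ν) μ

    counit : (μ : PSh X) → (S *) (G μ) ⊴ μ
    counit μ = ⊴⇒*⊴ (G μ) μ (⊴-refl (G μ))

  ≼-restrict : {I J : Set o} (f : I → J) {a b : I → Carrier} {a' b' : J → Carrier} →
               ((i : I) → a' (f i) ≡ a i) → ((i : I) → b' (f i) ≡ b i) →
               ((j : J) → a' j ≼ b' j) → (i : I) → a i ≼ b i
  ≼-restrict f a'f≡a b'f≡b a'≼b' i = subst₂ _≼_ (a'f≡a i) (b'f≡b i) (a'≼b' (f i))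

theorem11 : {c ℓ o : Level} (L : CCRL c ℓ o) →
    let open Enriched L in
    (X X' A : ECat) (R : EFunctor X A) (μ : PSh X)
    (R' : EFunctor X' A) (μ' : PSh X') (i : EFunctor X X') →
    ((x : Obj X) → fun R' (fun i x) ≡ fun R x) →
    ((x : Obj X) → ap μ' (fun i x) ≡ ap μ x) →
    (upR : PSh X → PSh A) → IsUpperApprox R upR →
    (upR' : PSh X' → PSh A) → IsUpperApprox R' upR' →
    (loR : PSh X → PSh A) → IsLowerApprox R loR →
    (loR' : PSh X' → PSh A) → IsLowerApprox R' loR' →
    (upR μ ⊴ upR' μ') × (loR' μ' ⊴ loR μ)
theorem11 L X X' A R μ R' μ' i R'i≡R μ'i≡μ upR up upR' up' loR lo loR' lo' =
  Up.⊴*⇒⊴ μ (upR' μ')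
    (≼-restrict (fun i) μ'i≡μ (cong (ap (upR' μ')) ∘ R'i≡R) (Up'.unit μ')) ,
  Lo.*⊴⇒⊴ (loR' μ') μ
    (≼-restrict (fun i) (cong (ap (loR' μ')) ∘ R'i≡R) μ'i≡μ (Lo'.counit μ'))
  where
  open Enriched L
  open Approximations L
  module Up  = UpperApprox R  upR  up
  module Up' = UpperApprox R' upR' up'
  module Lo  = LowerApprox R  loR  lo
  module Lo' = LowerApprox R' loR' lo'
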